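{- For every integer $n \ge 15$, the doubly metric dimension of the Johnson graph $J_{n,2}$ is $\psi(J_{n,2}) = \lceil 2n/3 \rceil$.
   Context: The Johnson graph $J_{n,2}$ has as vertices all $2$-element subsets of $[n]=\{1,\dots,n\}$, two being adjacent iff they share exactly one element; $d$ denotes shortest-path distance. Vertices $x,y$ doubly resolve vertices $u,v$ if $d(u,x)-d(u,y)\ne d(v,x)-d(v,y)$. A vertex set $D$ is a doubly resolving set if every two distinct vertices are doubly resolved by some two vertices of $D$; $\psi(G)$ is the minimum cardinality of a doubly resolving set of $G$. -}

module Defs where

open import Data.Nat using (ℕ; zero; suc; _+_; _*_; _<_)
open import Data.Nat.DivMod using (_/_)
open import Data.Fin using (Fin)
import Data.Fin as F
open import Data.Product using (Σ; _×_; _,_)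
open import Data.Sum using (_⊎_)
open import Data.List using (List; length)
open import Data.List.Membership.Propositional using (_∈_)
open import Data.List.Relation.Unary.Unique.Propositional using (Unique)
open import Relation.Binary.PropositionalEquality using (_≡_; _≢_)
open import Relation.Nullary using (¬_)

-- Vertices of J_{n,2}: 2-element subsets {i, j} of [n], represented canonically with i < j.
record Pair (n : ℕ) : Set where
  constructor ⟨_,_∣_⟩
  field
    lo : Fin n
    hi : Fin n
    lo<hi : lo F.< hi
open Pair public

_∈₂_ : {n : ℕ} → Fin n → Pair n → Set
x ∈₂ A = x ≡ lo A ⊎ x ≡ hi A

Adj : {n : ℕ} → Pair n → Pair n → Set
Adj {n} A B = Σ (Fin n) λ x → x ∈₂ A × x ∈₂ B × (∀ y → y ∈₂ A → y ∈₂ B → y ≡ x)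

data Walk {n : ℕ} : Pair n → Pair n → ℕ → Set where
  here : ∀ {u} → Walk u u 0
  step : ∀ {u w v k} → Adj u w → Walk w v k → Walk u v (suc k)

Dist : {n : ℕ} → Pair n → Pair n → ℕ → Set
Dist u v k = Walk u v k × (∀ m → m < k → ¬ Walk u v m)

-- x, y doubly resolve u, v :  d(u,x) - d(u,y) ≠ d(v,x) - d(v,y)
-- (written additively over ℕ: a - b ≠ c - e  ⇔  a + e ≠ b + c)
DoublyResolves : {n : ℕ} → Pair n → Pair n → Pair n → Pair n → Set
DoublyResolves x y u v =
  ∀ a b c e → Dist u x a → Dist u y b → Dist v x c → Dist v y e → a + e ≢ b + c

IsDoublyResolving : {n : ℕ} → List (Pair n) → Set
IsDoublyResolving {n} D =
  (u v : Pair n) → u ≢ v →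
  Σ (Pair n) λ x → Σ (Pair n) λ y → x ∈ D × y ∈ D × DoublyResolves x y u v

ψ-J2-is : ℕ → ℕ → Set
ψ-J2-is n k =
  (Σ (List (Pair n)) λ D → Unique D × IsDoublyResolving D × length D ≡ k)
  × (∀ (D : List (Pair n)) → Unique D → IsDoublyResolving D → k Data.Nat.≤ length D)

ceil2n/3 : ℕ → ℕ
ceil2n/3 n = (2 * n + 2) / 3

-- The distance in J(n,2) is d(u,x) = 2 − |u ∩ x|, so x, y doubly resolve u, v exactly when
-- |u ∩ x| + |v ∩ y| ≠ |u ∩ y| + |v ∩ x|.  View a set D of pairs as a graph on [n].
--
-- If a ≠ b lie in the same edges of D, then D does not resolve {a,c} and {b,c}.
-- Hence D has at most one isolated vertex z and no isolated edge, and if z exists, no vertex v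
-- has exactly two neighbours that are both leaves (D does not resolve {v,z} and those leaves).
-- Every edge hands out 12 units: X to an endpoint that is a leaf, 12 − X to the other endpoint
-- of such an edge, 6 to each endpoint otherwise.  Without isolated vertices take X = 8: every
-- vertex gets at least 8.  With an isolated vertex z take X = 9: every other vertex gets at
-- least 9.  So 8n ≤ 12|D| or 9(n − 1) ≤ 12|D|, and either gives 2n ≤ 3|D| for n ≥ 6.
--
-- Cut [n] into blocks {3j, 3j+1, 3j+2} centred at 3j+2, attach the one or two
-- remaining points to the last centre, and join every other point to its centre: ⌈2n/3⌉ edges.
-- For u ≠ v some star edge x meets u and v in different numbers of points (this is where every
-- star needs two leaves), and one of the five disjoint edges {3j, 3j+2}, j < 5, is some y
-- disjoint from u ∪ v; then x, y resolve u, v.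

module Submission where

open import Defs
open import Data.Bool using (if_then_else_)
open import Data.Empty using (⊥; ⊥-elim)
open import Data.Empty.Irrelevant renaming (⊥-elim to ⊥-elim-irr)
open import Data.Fin as F using (Fin)
import Data.Fin.Properties as F
open import Data.Fin.Patterns using (0F; 1F; 2F; 3F)
open import Data.List using (List; []; _∷_; length; filter; map; tabulate; allFin)
open import Data.List.Membership.Propositional using (_∈_; find)
open import Data.List.Membership.Propositional.Properties using (∈-filter⁺; ∈-filter⁻; ∈-allFin)
open import Data.List.Relation.Unary.All as All using (_∷_)
open import Data.List.Relation.Unary.All.Properties using (¬All⇒Any¬)
open import Data.List.Relation.Unary.AllPairs using ([]; _∷_)
open import Data.List.Relation.Unary.Any using (here; there)
open import Data.List.Relation.Unary.Unique.Propositional using (Unique)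
import Data.List.Relation.Unary.Unique.Propositional.Properties as Unique
open import Data.Nat using (ℕ; zero; suc; _+_; _*_; _∸_; _≤_; _<_; _≟_; _≤?_; _<?_; z≤n; s≤s)
import Data.Nat.Properties as ℕ
open import Data.Nat.DivMod using (_/_; m<n*o⇒m/o<n; m/n≡1+[m∸n]/n)
open import Data.Nat.ListAction using (sum)
open import Data.Nat.Tactic.RingSolver using (solve-∀)
open import Algebra.Properties.CommutativeSemigroup ℕ.+-commutativeSemigroup using (interchange)
open import Algebra.Properties.CommutativeMonoid.Sum ℕ.+-0-commutativeMonoid
  using (sum-syntax; sum-cong-≗; sum-replicate-zero; ∑-distrib-+)
open import Data.Product using (Σ; ∃; ∃₂; _×_; _,_; proj₁; proj₂)
open import Data.Sum using (_⊎_; inj₁; inj₂; [_,_]′)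
open import Function.Base using (_∘_; id)
open import Function.Bundles using (_⇔_; mk⇔; Equivalence)
open import Relation.Binary.Definitions using (tri<; tri≈; tri>)
open import Relation.Binary.PropositionalEquality
open import Relation.Nullary using (Dec; yes; no; does; ¬_; ¬?; contradiction)
open import Relation.Nullary.Decidable using (_⊎-dec_; _×-dec_)
open import Relation.Unary using (Decidable)

private variable
  n : ℕ
  P Q A : Set

𝟙 : Dec P → ℕ
𝟙 d = if does d then 1 else 0

𝟙-yes : (d : Dec P) → P → 𝟙 d ≡ 1
𝟙-yes (yes _) _ = refl
𝟙-yes (no ¬p) p = contradiction p ¬p

𝟙-no : (d : Dec P) → ¬ P → 𝟙 d ≡ 0
𝟙-no (yes p) ¬p = contradiction p ¬p
𝟙-no (no _) _ = refl

𝟙≤1 : (d : Dec P) → 𝟙 d ≤ 1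
𝟙≤1 (yes _) = s≤s z≤n
𝟙≤1 (no _) = z≤n

𝟙-cong : (d : Dec P) (d′ : Dec Q) → (P → Q) → (Q → P) → 𝟙 d ≡ 𝟙 d′
𝟙-cong (yes _) (yes _) _ _ = refl
𝟙-cong (no _) (no _) _ _ = refl
𝟙-cong (yes p) (no ¬q) f _ = contradiction (f p) ¬q
𝟙-cong (no ¬p) (yes q) _ g = contradiction (g q) ¬p

𝟙-transfer : {P P′ Q Q′ : Set} (p? : Dec P) (q? : Dec Q) (p′? : Dec P′) (q′? : Dec Q′) →
             𝟙 p? + 𝟙 q? ≡ 𝟙 p′? + 𝟙 q′? → P → ¬ P′ → Q′ × ¬ Q
𝟙-transfer {Q = Q} {Q′} p? q? p′? q′? eq p ¬p′ =
  settle q? q′? (subst₂ (λ a b → a + 𝟙 q? ≡ b + 𝟙 q′?) (𝟙-yes p? p) (𝟙-no p′? ¬p′) eq)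
  where
  settle : (q? : Dec Q) (q′? : Dec Q′) → 1 + 𝟙 q? ≡ 0 + 𝟙 q′? → Q′ × ¬ Q
  settle (no ¬q) (yes q′) _ = q′ , ¬q
  settle (yes _) (yes _) ()
  settle (yes _) (no _) ()
  settle (no _) (no _) ()

Pair-ext : {A B : Pair n} → lo A ≡ lo B → hi A ≡ hi B → A ≡ B
Pair-ext {A = ⟨ a , b ∣ p ⟩} {⟨ .a , .b ∣ q ⟩} refl refl = cong ⟨ a , b ∣_⟩ (F.<-irrelevant p q)

lo≢hi : (A : Pair n) → lo A ≢ hi A
lo≢hi A = F.<⇒≢ (lo<hi A)

_∈₂?_ : (x : Fin n) (A : Pair n) → Dec (x ∈₂ A)
x ∈₂? A = (x F.≟ lo A) ⊎-dec (x F.≟ hi A)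

∈₂-distinct : (A : Pair n) {a b : Fin n} → a ∈₂ A → b ∈₂ A → a ≢ b →
              (a ≡ lo A × b ≡ hi A) ⊎ (a ≡ hi A × b ≡ lo A)
∈₂-distinct A (inj₁ p) (inj₂ q) _ = inj₁ (p , q)
∈₂-distinct A (inj₂ p) (inj₁ q) _ = inj₂ (p , q)
∈₂-distinct A (inj₁ p) (inj₁ q) a≢b = contradiction (trans p (sym q)) a≢b
∈₂-distinct A (inj₂ p) (inj₂ q) a≢b = contradiction (trans p (sym q)) a≢b

⊆⇒≡ : (A B : Pair n) → lo A ∈₂ B → hi A ∈₂ B → A ≡ B
⊆⇒≡ A B p q with ∈₂-distinct B p q (lo≢hi A)
... | inj₁ (l , h) = Pair-ext l h
... | inj₂ (l , h) = ⊥-elim (F.<-asym (lo<hi B) (subst₂ F._<_ l h (lo<hi A)))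

pair-unique : {a b : Fin n} {A B : Pair n} → a ≢ b → a ∈₂ A → b ∈₂ A → a ∈₂ B → b ∈₂ B → A ≡ B
pair-unique {A = A} {B} a≢b a∈A b∈A a∈B b∈B with ∈₂-distinct A a∈A b∈A a≢b
... | inj₁ (refl , refl) = ⊆⇒≡ A B a∈B b∈B
... | inj₂ (refl , refl) = ⊆⇒≡ A B b∈B a∈B

otherEnd : Pair n → Fin n → Fin n
otherEnd e v with v F.≟ lo e
... | yes _ = hi e
... | no _ = lo e

otherEnd-lo : (e : Pair n) → otherEnd e (lo e) ≡ hi e
otherEnd-lo e with lo e F.≟ lo e
... | yes _ = refl
... | no lo≢lo = contradiction refl lo≢lo

otherEnd-hi : (e : Pair n) → otherEnd e (hi e) ≡ lo e
otherEnd-hi e with hi e F.≟ lo e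
... | yes hi≡lo = contradiction (sym hi≡lo) (lo≢hi e)
... | no _ = refl

otherEnd-∈ : {v : Fin n} (e : Pair n) → v ∈₂ e → otherEnd e v ∈₂ e
otherEnd-∈ {v = v} e v∈e with v F.≟ lo e | v∈e
... | yes _ | _ = inj₂ refl
... | no _ | _ = inj₁ refl

otherEnd-≢ : {v : Fin n} (e : Pair n) → v ∈₂ e → otherEnd e v ≢ v
otherEnd-≢ {v = v} e v∈e with v F.≟ lo e | v∈e
... | yes v≡lo | _ = λ hi≡v → lo≢hi e (trans (sym v≡lo) (sym hi≡v))
... | no v≢lo | inj₁ v≡lo = contradiction v≡lo v≢lo
... | no _ | inj₂ v≡hi = λ lo≡v → lo≢hi e (trans lo≡v v≡hi)

∈₂-otherEnd : {v y : Fin n} (e : Pair n) → v ∈₂ e → y ∈₂ e → y ≡ v ⊎ y ≡ otherEnd e v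
∈₂-otherEnd {v = v} e v∈e y∈e with v F.≟ lo e | v∈e | y∈e
... | yes v≡lo | _ | inj₁ y≡lo = inj₁ (trans y≡lo (sym v≡lo))
... | yes _ | _ | inj₂ y≡hi = inj₂ y≡hi
... | no v≢lo | inj₁ v≡lo | _ = contradiction v≡lo v≢lo
... | no _ | inj₂ v≡hi | inj₁ y≡lo = inj₂ y≡lo
... | no _ | inj₂ v≡hi | inj₂ y≡hi = inj₁ (trans y≡hi (sym v≡hi))

otherEnd-∉ : {v : Fin n} {e e′ : Pair n} → v ∈₂ e → v ∈₂ e′ → e ≢ e′ → ¬ otherEnd e′ v ∈₂ e
otherEnd-∉ {e = e} {e′} v∈e v∈e′ e≢e′ o′∈e with ∈₂-otherEnd e v∈e o′∈e
... | inj₁ o′≡v = otherEnd-≢ e′ v∈e′ o′≡v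
... | inj₂ o′≡o = e≢e′ (pair-unique (otherEnd-≢ e v∈e ∘ sym) v∈e (otherEnd-∈ e v∈e)
                                    v∈e′ (subst (_∈₂ e′) o′≡o (otherEnd-∈ e′ v∈e′)))

pairOf : (a b : Fin n) → .(a ≢ b) → Pair n
pairOf a b a≢b with F.<-cmp a b
... | tri< a<b _ _ = ⟨ a , b ∣ a<b ⟩
... | tri≈ _ a≡b _ = ⊥-elim-irr (a≢b a≡b)
... | tri> _ _ b<a = ⟨ b , a ∣ b<a ⟩

∈-pairOfˡ : (a b : Fin n) .(a≢b : a ≢ b) → a ∈₂ pairOf a b a≢b
∈-pairOfˡ a b a≢b with F.<-cmp a b
... | tri< _ _ _ = inj₁ refl
... | tri≈ _ a≡b _ = ⊥-elim-irr (a≢b a≡b)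
... | tri> _ _ _ = inj₂ refl

∈-pairOfʳ : (a b : Fin n) .(a≢b : a ≢ b) → b ∈₂ pairOf a b a≢b
∈-pairOfʳ a b a≢b with F.<-cmp a b
... | tri< _ _ _ = inj₂ refl
... | tri≈ _ a≡b _ = ⊥-elim-irr (a≢b a≡b)
... | tri> _ _ _ = inj₁ refl

∈-pairOf⁻ : (a b : Fin n) .(a≢b : a ≢ b) {y : Fin n} → y ∈₂ pairOf a b a≢b → y ≡ a ⊎ y ≡ b
∈-pairOf⁻ a b a≢b y∈ with F.<-cmp a b | y∈
... | tri< _ _ _ | inj₁ y≡a = inj₁ y≡a
... | tri< _ _ _ | inj₂ y≡b = inj₂ y≡b
... | tri≈ _ a≡b _ | _ = ⊥-elim-irr (a≢b a≡b)
... | tri> _ _ _ | inj₁ y≡b = inj₂ y≡b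
... | tri> _ _ _ | inj₂ y≡a = inj₁ y≡a

-- Intersection sizes and distances

∣_∩_∣ : Pair n → Pair n → ℕ
∣ u ∩ x ∣ = 𝟙 (lo u ∈₂? x) + 𝟙 (hi u ∈₂? x)

data Overlap (u x : Pair n) : ℕ → Set where
  equal    : u ≡ x → Overlap u x 2
  adjacent : Adj u x → Overlap u x 1
  disjoint : ¬ lo u ∈₂ x → ¬ hi u ∈₂ x → Overlap u x 0

overlapOf : (u x : Pair n) → Overlap u x ∣ u ∩ x ∣
overlapOf u x = view (lo u ∈₂? x) (hi u ∈₂? x)
  where
  view : (l : Dec (lo u ∈₂ x)) (h : Dec (hi u ∈₂ x)) → Overlap u x (𝟙 l + 𝟙 h)
  view (yes l) (yes h) = equal (⊆⇒≡ u x l h)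
  view (yes l) (no ¬h) = adjacent (lo u , inj₁ refl , l ,
    λ { y (inj₁ y≡lo) _ → y≡lo ; y (inj₂ refl) y∈x → contradiction y∈x ¬h })
  view (no ¬l) (yes h) = adjacent (hi u , inj₂ refl , h ,
    λ { y (inj₂ y≡hi) _ → y≡hi ; y (inj₁ refl) y∈x → contradiction y∈x ¬l })
  view (no ¬l) (no ¬h) = disjoint ¬l ¬h

∣∩∣≤2 : (u x : Pair n) → ∣ u ∩ x ∣ ≤ 2
∣∩∣≤2 u x = ℕ.+-mono-≤ (𝟙≤1 (lo u ∈₂? x)) (𝟙≤1 (hi u ∈₂? x))

∣∩-self∣ : (u : Pair n) → ∣ u ∩ u ∣ ≡ 2
∣∩-self∣ u = cong₂ _+_ (𝟙-yes (lo u ∈₂? u) (inj₁ refl)) (𝟙-yes (hi u ∈₂? u) (inj₂ refl))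

𝟙-∈₂ : (y : Fin n) (A : Pair n) → 𝟙 (y ∈₂? A) ≡ 𝟙 (y F.≟ lo A) + 𝟙 (y F.≟ hi A)
𝟙-∈₂ y A with y F.≟ lo A | y F.≟ hi A
... | yes refl | yes y≡hi = contradiction y≡hi (lo≢hi A)
... | yes _ | no _ = refl
... | no _ | yes _ = refl
... | no _ | no _ = refl

∩-comm : (u x : Pair n) → ∣ u ∩ x ∣ ≡ ∣ x ∩ u ∣
∩-comm u x = begin
  𝟙 (lo u ∈₂? x) + 𝟙 (hi u ∈₂? x)            ≡⟨ cong₂ _+_ (𝟙-∈₂ (lo u) x) (𝟙-∈₂ (hi u) x) ⟩
  (eq lu lx + eq lu hx) + (eq hu lx + eq hu hx) ≡⟨ interchange (eq lu lx) (eq lu hx) (eq hu lx) (eq hu hx) ⟩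
  (eq lu lx + eq hu lx) + (eq lu hx + eq hu hx) ≡⟨ cong₂ _+_ (cong₂ _+_ (eq-sym lu lx) (eq-sym hu lx))
                                                           (cong₂ _+_ (eq-sym lu hx) (eq-sym hu hx)) ⟩
  (eq lx lu + eq lx hu) + (eq hx lu + eq hx hu) ≡⟨ cong₂ _+_ (𝟙-∈₂ (lo x) u) (𝟙-∈₂ (hi x) u) ⟨
  𝟙 (lo x ∈₂? u) + 𝟙 (hi x ∈₂? u)            ∎
  where
  open ≡-Reasoning
  lu = lo u ; hu = hi u ; lx = lo x ; hx = hi x
  eq : Fin n → Fin n → ℕ
  eq a b = 𝟙 (a F.≟ b)
  eq-sym : ∀ a b → eq a b ≡ eq b a
  eq-sym a b = 𝟙-cong (a F.≟ b) (b F.≟ a) sym sym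

∉-≢ : {y : Fin n} {A B : Pair n} → y ∈₂ A → ¬ y ∈₂ B → A ≢ B
∉-≢ y∈A y∉B refl = y∉B y∈A

disjoint-sym : {u x : Pair n} {y : Fin n} → ¬ lo u ∈₂ x → ¬ hi u ∈₂ x → y ∈₂ x → ¬ y ∈₂ u
disjoint-sym ¬l _ y∈x (inj₁ refl) = ¬l y∈x
disjoint-sym _ ¬h y∈x (inj₂ refl) = ¬h y∈x

¬Adj-refl : (u : Pair n) → ¬ Adj u u
¬Adj-refl u (_ , _ , _ , unique) =
  lo≢hi u (trans (unique (lo u) (inj₁ refl) (inj₁ refl)) (sym (unique (hi u) (inj₂ refl) (inj₂ refl))))

shared⇒Adj : {z : Fin n} {A B : Pair n} → z ∈₂ A → z ∈₂ B → A ≢ B → Adj A B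
shared⇒Adj {z = z} {A} {B} z∈A z∈B A≢B = z , z∈A , z∈B , unique
  where
  unique : ∀ y → y ∈₂ A → y ∈₂ B → y ≡ z
  unique y y∈A y∈B with y F.≟ z
  ... | yes y≡z = y≡z
  ... | no y≢z = contradiction (pair-unique y≢z y∈A z∈A y∈B z∈B) A≢B

Adj⇒∣∩∣≡1 : {u x : Pair n} → Adj u x → ∣ u ∩ x ∣ ≡ 1
Adj⇒∣∩∣≡1 {u = u} {x} adj with ∣ u ∩ x ∣ | overlapOf u x | adj
... | .2 | equal refl | _ = contradiction adj (¬Adj-refl u)
... | .1 | adjacent _ | _ = refl
... | .0 | disjoint ¬l _ | (_ , inj₁ refl , z∈x , _) = contradiction z∈x ¬l
... | .0 | disjoint _ ¬h | (_ , inj₂ refl , z∈x , _) = contradiction z∈x ¬h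

∣∩∣≢0⇒∈ : (u x : Pair n) → ∣ u ∩ x ∣ ≢ 0 → lo u ∈₂ x ⊎ hi u ∈₂ x
∣∩∣≢0⇒∈ u x ≢0 with ∣ u ∩ x ∣ | overlapOf u x
... | .2 | equal refl = inj₁ (inj₁ refl)
... | .1 | adjacent (_ , inj₁ refl , z∈x , _) = inj₁ z∈x
... | .1 | adjacent (_ , inj₂ refl , z∈x , _) = inj₂ z∈x
... | .0 | disjoint _ _ = contradiction refl ≢0

walk : (u x : Pair n) → Walk u x (2 ∸ ∣ u ∩ x ∣)
walk u x with ∣ u ∩ x ∣ | overlapOf u x
... | .2 | equal refl = here
... | .1 | adjacent adj = step adj here
... | .0 | disjoint ¬l ¬h = step {w = w} (shared⇒Adj (inj₁ refl) (∈-pairOfˡ _ _ lo≢lo) u≢w)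
                                 (step (shared⇒Adj (∈-pairOfʳ _ _ lo≢lo) (inj₁ refl) w≢x) here)
  where
  lo≢lo : lo u ≢ lo x
  lo≢lo e = ¬l (inj₁ e)
  w = pairOf (lo u) (lo x) lo≢lo
  u≢w : u ≢ w
  u≢w u≡w = ∉-≢ (∈-pairOfʳ (lo u) (lo x) lo≢lo) (disjoint-sym {u = u} {x} ¬l ¬h (inj₁ refl)) (sym u≡w)
  w≢x : w ≢ x
  w≢x = ∉-≢ (∈-pairOfˡ (lo u) (lo x) lo≢lo) ¬l

no-shorter-walk : (u x : Pair n) (m : ℕ) → m < 2 ∸ ∣ u ∩ x ∣ → ¬ Walk u x m
no-shorter-walk u .u 0 0<d here with () ← subst (λ k → 0 < 2 ∸ k) (∣∩-self∣ u) 0<d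
no-shorter-walk u x 1 1<d (step adj here) with s≤s () ← subst (λ k → 1 < 2 ∸ k) (Adj⇒∣∩∣≡1 {u = u} {x} adj) 1<d
no-shorter-walk u x (suc (suc m)) m+2<d _ with s≤s (s≤s ()) ← ℕ.≤-trans m+2<d (ℕ.m∸n≤m 2 ∣ u ∩ x ∣)

dist : (u x : Pair n) → Dist u x (2 ∸ ∣ u ∩ x ∣)
dist u x = walk u x , no-shorter-walk u x

Dist-functional : {u v : Pair n} {k k′ : ℕ} → Dist u v k → Dist u v k′ → k ≡ k′
Dist-functional {k = k} {k′} (w , shortest) (w′ , shortest′) with ℕ.<-cmp k k′
... | tri< k<k′ _ _ = contradiction w (shortest′ k k<k′)
... | tri≈ _ k≡k′ _ = k≡k′
... | tri> _ _ k′<k = contradiction w′ (shortest k′ k′<k)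

complements-+ : {m p q : ℕ} → p ≤ m → q ≤ m → (m ∸ p) + (m ∸ q) + (p + q) ≡ m + m
complements-+ {m} {p} {q} p≤m q≤m =
  trans (interchange (m ∸ p) (m ∸ q) p q) (cong₂ _+_ (ℕ.m∸n+n≡m p≤m) (ℕ.m∸n+n≡m q≤m))

complements-+-≡⇔ : {m p q r s : ℕ} → p ≤ m → q ≤ m → r ≤ m → s ≤ m →
                   ((m ∸ p) + (m ∸ q) ≡ (m ∸ r) + (m ∸ s)) ⇔ (p + q ≡ r + s)
complements-+-≡⇔ {m} {p} {q} {r} {s} p≤m q≤m r≤m s≤m = mk⇔
  (λ eq → ℕ.+-cancelˡ-≡ ((m ∸ r) + (m ∸ s)) (p + q) (r + s)
            (trans (subst (λ t → t + (p + q) ≡ m + m) eq (complements-+ p≤m q≤m))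
                   (sym (complements-+ r≤m s≤m))))
  (λ eq → ℕ.+-cancelʳ-≡ (r + s) ((m ∸ p) + (m ∸ q)) ((m ∸ r) + (m ∸ s))
            (trans (subst (λ t → (m ∸ p) + (m ∸ q) + t ≡ m + m) eq (complements-+ p≤m q≤m))
                   (sym (complements-+ r≤m s≤m))))

DoublyResolves⇔ : (x y u v : Pair n) →
                  DoublyResolves x y u v ⇔ (∣ u ∩ x ∣ + ∣ v ∩ y ∣ ≢ ∣ u ∩ y ∣ + ∣ v ∩ x ∣)
DoublyResolves⇔ x y u v = mk⇔
  (λ resolves eq → resolves _ _ _ _ (dist u x) (dist u y) (dist v x) (dist v y) (Equivalence.from distances⇔ eq))
  (λ { ne _ _ _ _ ux uy vx vy eq → ne (Equivalence.to distances⇔ (subst₂ _≡_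
        (cong₂ _+_ (Dist-functional ux (dist u x)) (Dist-functional vy (dist v y)))
        (cong₂ _+_ (Dist-functional uy (dist u y)) (Dist-functional vx (dist v x))) eq)) })
  where
  distances⇔ = complements-+-≡⇔ (∣∩∣≤2 u x) (∣∩∣≤2 v y) (∣∩∣≤2 u y) (∣∩∣≤2 v x)

-- Obstructions to double resolvability

Indistinguishable : List (Pair n) → Pair n → Pair n → Set
Indistinguishable D u v = ∀ x → x ∈ D → ∣ u ∩ x ∣ ≡ ∣ v ∩ x ∣

indistinguishable⇒¬DoublyResolving : {D : List (Pair n)} {u v : Pair n} →
                                     u ≢ v → Indistinguishable D u v → ¬ IsDoublyResolving D
indistinguishable⇒¬DoublyResolving {u = u} {v} u≢v same resolving with resolving u v u≢v
... | x , y , x∈D , y∈D , resolves = Equivalence.to (DoublyResolves⇔ x y u v) resolves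
        (trans (cong₂ _+_ (same x x∈D) (sym (same y y∈D))) (ℕ.+-comm ∣ v ∩ x ∣ ∣ u ∩ y ∣))

∣pairOf∩∣ : (a b : Fin n) .(a≢b : a ≢ b) (x : Pair n) → ∣ pairOf a b a≢b ∩ x ∣ ≡ 𝟙 (a ∈₂? x) + 𝟙 (b ∈₂? x)
∣pairOf∩∣ a b a≢b x with F.<-cmp a b
... | tri< _ _ _ = refl
... | tri≈ _ a≡b _ = ⊥-elim-irr (a≢b a≡b)
... | tri> _ _ _ = ℕ.+-comm (𝟙 (b ∈₂? x)) (𝟙 (a ∈₂? x))

third : 3 ≤ n → (a b : Fin n) → a ≢ b → ∃ λ c → c ≢ a × c ≢ b
third {suc (suc zero)} (s≤s (s≤s ()))
third {suc (suc (suc _))} _ a b a≢b =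
  c , F.punchInᵢ≢i a _ , λ c≡b → F.punchInᵢ≢i b′ F.zero
                                   (F.punchIn-injective a _ _ (trans c≡b (sym (F.punchIn-punchOut a≢b))))
  where
  b′ = F.punchOut a≢b
  c = F.punchIn a (F.punchIn b′ F.zero)

twins⇒¬DoublyResolving : {D : List (Pair n)} {a b : Fin n} → 3 ≤ n → a ≢ b →
                         (∀ x → x ∈ D → (a ∈₂ x ⇔ b ∈₂ x)) → ¬ IsDoublyResolving D
twins⇒¬DoublyResolving {D = D} {a} {b} 3≤n a≢b twins with third 3≤n a b a≢b
... | c , c≢a , c≢b = indistinguishable⇒¬DoublyResolving u≢v same
  where
  u = pairOf a c (c≢a ∘ sym)
  v = pairOf b c (c≢b ∘ sym)
  u≢v : u ≢ v
  u≢v u≡v with ∈-pairOf⁻ b c _ (subst (a ∈₂_) u≡v (∈-pairOfˡ a c _))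
  ... | inj₁ a≡b = a≢b a≡b
  ... | inj₂ a≡c = c≢a (sym a≡c)
  same : Indistinguishable D u v
  same x x∈D = begin
    ∣ u ∩ x ∣                    ≡⟨ ∣pairOf∩∣ a c _ x ⟩
    𝟙 (a ∈₂? x) + 𝟙 (c ∈₂? x)  ≡⟨ cong (_+ 𝟙 (c ∈₂? x)) (𝟙-cong (a ∈₂? x) (b ∈₂? x) to from) ⟩
    𝟙 (b ∈₂? x) + 𝟙 (c ∈₂? x)  ≡⟨ ∣pairOf∩∣ b c _ x ⟨
    ∣ v ∩ x ∣                    ∎
    where
    open ≡-Reasoning
    open Equivalence (twins x x∈D)

length≡0⇒∉ : {xs : List A} {x : A} → length xs ≡ 0 → ¬ x ∈ xs
length≡0⇒∉ {xs = []} _ ()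

length≡1⇒≡ : {xs : List A} {x y : A} → length xs ≡ 1 → x ∈ xs → y ∈ xs → x ≡ y
length≡1⇒≡ {xs = _ ∷ []} _ (here refl) (here refl) = refl

length≡2⇒∷∷ : {xs : List A} → length xs ≡ 2 → ∃₂ λ a b → xs ≡ a ∷ b ∷ []
length≡2⇒∷∷ {xs = a ∷ b ∷ []} _ = a , b , refl

incident : List (Pair n) → Fin n → List (Pair n)
incident D v = filter (v ∈₂?_) D

degree : List (Pair n) → Fin n → ℕ
degree D v = length (incident D v)

degree≡0⇒∉ : {D : List (Pair n)} {v : Fin n} {x : Pair n} → degree D v ≡ 0 → x ∈ D → ¬ v ∈₂ x
degree≡0⇒∉ {v = v} d≡0 x∈D v∈x = length≡0⇒∉ d≡0 (∈-filter⁺ (v ∈₂?_) x∈D v∈x)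

degree≡1⇒≡ : {D : List (Pair n)} {v : Fin n} {x y : Pair n} → degree D v ≡ 1 →
             x ∈ D → v ∈₂ x → y ∈ D → v ∈₂ y → x ≡ y
degree≡1⇒≡ {v = v} d≡1 x∈D v∈x y∈D v∈y =
  length≡1⇒≡ d≡1 (∈-filter⁺ (v ∈₂?_) x∈D v∈x) (∈-filter⁺ (v ∈₂?_) y∈D v∈y)

leaf∈⇒neighbour∈ : {D : List (Pair n)} {v : Fin n} {e x : Pair n} → e ∈ D → v ∈₂ e →
                   degree D (otherEnd e v) ≡ 1 → x ∈ D → otherEnd e v ∈₂ x → v ∈₂ x
leaf∈⇒neighbour∈ {v = v} {e} e∈D v∈e d≡1 x∈D o∈x =
  subst (v ∈₂_) (degree≡1⇒≡ d≡1 e∈D (otherEnd-∈ e v∈e) x∈D o∈x) v∈e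

module _ {D : List (Pair n)} (3≤n : 3 ≤ n) (resolving : IsDoublyResolving D) where

  isolated-unique : {a b : Fin n} → degree D a ≡ 0 → degree D b ≡ 0 → a ≡ b
  isolated-unique {a} {b} da≡0 db≡0 with a F.≟ b
  ... | yes a≡b = a≡b
  ... | no a≢b = contradiction resolving (twins⇒¬DoublyResolving 3≤n a≢b λ x x∈D →
        mk⇔ (λ a∈x → contradiction a∈x (degree≡0⇒∉ da≡0 x∈D)) (λ b∈x → contradiction b∈x (degree≡0⇒∉ db≡0 x∈D)))

  ¬isolatedEdge : {e : Pair n} → e ∈ D → degree D (lo e) ≡ 1 → degree D (hi e) ≡ 1 → ⊥
  ¬isolatedEdge {e} e∈D dlo≡1 dhi≡1 = twins⇒¬DoublyResolving 3≤n (lo≢hi e) twins resolving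
    where
    twins : ∀ x → x ∈ D → (lo e ∈₂ x ⇔ hi e ∈₂ x)
    twins x x∈D = mk⇔ (λ lo∈x → subst (hi e ∈₂_) (degree≡1⇒≡ dlo≡1 e∈D (inj₁ refl) x∈D lo∈x) (inj₂ refl))
                      (λ hi∈x → subst (lo e ∈₂_) (degree≡1⇒≡ dhi≡1 e∈D (inj₂ refl) x∈D hi∈x) (inj₁ refl))

¬isolatedCherry : {D : List (Pair n)} → Unique D → IsDoublyResolving D →
                  {z v : Fin n} {e₁ e₂ : Pair n} → degree D z ≡ 0 → incident D v ≡ e₁ ∷ e₂ ∷ [] →
                  degree D (otherEnd e₁ v) ≡ 1 → degree D (otherEnd e₂ v) ≡ 1 → ⊥
¬isolatedCherry {D = D} unique resolving {z} {v} {e₁} {e₂} dz≡0 incident≡ d₁≡1 d₂≡1 =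
  indistinguishable⇒¬DoublyResolving u≢w indist resolving
  where
  e₁∈D×v∈e₁ = ∈-filter⁻ (v ∈₂?_) {xs = D} (subst (e₁ ∈_) (sym incident≡) (here refl))
  e₂∈D×v∈e₂ = ∈-filter⁻ (v ∈₂?_) {xs = D} (subst (e₂ ∈_) (sym incident≡) (there (here refl)))
  e₁∈D = proj₁ e₁∈D×v∈e₁
  v∈e₁ = proj₂ e₁∈D×v∈e₁
  e₂∈D = proj₁ e₂∈D×v∈e₂
  v∈e₂ = proj₂ e₂∈D×v∈e₂
  e₁≢e₂ : e₁ ≢ e₂
  e₁≢e₂ with subst Unique incident≡ (Unique.filter⁺ (v ∈₂?_) unique)
  ... | (e₁≢e₂ ∷ _) ∷ _ = e₁≢e₂
  o₁ = otherEnd e₁ v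
  o₂ = otherEnd e₂ v
  o₂∉e₁ = otherEnd-∉ v∈e₁ v∈e₂ e₁≢e₂
  o₁∉e₂ = otherEnd-∉ v∈e₂ v∈e₁ (e₁≢e₂ ∘ sym)
  o₁≢o₂ : o₁ ≢ o₂
  o₁≢o₂ o₁≡o₂ = o₂∉e₁ (subst (_∈₂ e₁) o₁≡o₂ (otherEnd-∈ e₁ v∈e₁))
  v≢z : v ≢ z
  v≢z refl = degree≡0⇒∉ dz≡0 e₁∈D v∈e₁
  u = pairOf v z v≢z
  w = pairOf o₁ o₂ o₁≢o₂
  u≢w : u ≢ w
  u≢w = ∉-≢ (∈-pairOfˡ v z v≢z) λ v∈w →
    [ otherEnd-≢ e₁ v∈e₁ ∘ sym , otherEnd-≢ e₂ v∈e₂ ∘ sym ]′ (∈-pairOf⁻ o₁ o₂ o₁≢o₂ v∈w)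
  indist : Indistinguishable D u w
  indist x x∈D rewrite ∣pairOf∩∣ v z v≢z x | ∣pairOf∩∣ o₁ o₂ o₁≢o₂ x | 𝟙-no (z ∈₂? x) (degree≡0⇒∉ dz≡0 x∈D) =
    byCases (v ∈₂? x)
    where
    byCases : (d : Dec (v ∈₂ x)) → 𝟙 d + 0 ≡ 𝟙 (o₁ ∈₂? x) + 𝟙 (o₂ ∈₂? x)
    byCases (no v∉x) rewrite 𝟙-no (o₁ ∈₂? x) (v∉x ∘ leaf∈⇒neighbour∈ e₁∈D v∈e₁ d₁≡1 x∈D)
                           | 𝟙-no (o₂ ∈₂? x) (v∉x ∘ leaf∈⇒neighbour∈ e₂∈D v∈e₂ d₂≡1 x∈D) = refl
    byCases (yes v∈x) with subst (x ∈_) incident≡ (∈-filter⁺ (v ∈₂?_) x∈D v∈x)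
    ... | here refl rewrite 𝟙-yes (o₁ ∈₂? x) (otherEnd-∈ e₁ v∈e₁) | 𝟙-no (o₂ ∈₂? x) o₂∉e₁ = refl
    ... | there (here refl) rewrite 𝟙-no (o₁ ∈₂? x) o₁∉e₂ | 𝟙-yes (o₂ ∈₂? x) (otherEnd-∈ e₂ v∈e₂) = refl

∑-mono-≤ : {f g : Fin n → ℕ} → (∀ i → f i ≤ g i) → ∑[ i < n ] f i ≤ ∑[ i < n ] g i
∑-mono-≤ {zero} _ = z≤n
∑-mono-≤ {suc n} f≤g = ℕ.+-mono-≤ (f≤g F.zero) (∑-mono-≤ (f≤g ∘ F.suc))

∑-const : (n c : ℕ) → ∑[ i < n ] c ≡ n * c
∑-const zero c = refl
∑-const (suc n) c = cong (c +_) (∑-const n c)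

∑-𝟙≟ : (a : Fin n) (c : ℕ) → ∑[ i < n ] (𝟙 (i F.≟ a) * c) ≡ c
∑-𝟙≟ {suc n} F.zero c =
  trans (cong (c + 0 +_) (sum-replicate-zero n)) (trans (ℕ.+-identityʳ (c + 0)) (ℕ.+-identityʳ c))
∑-𝟙≟ {suc n} (F.suc a) c = ∑-𝟙≟ a c

∑-sum-comm : (f : Fin n → A → ℕ) (xs : List A) →
             ∑[ i < n ] sum (map (f i) xs) ≡ sum (map (λ x → ∑[ i < n ] f i x) xs)
∑-sum-comm {n} f [] = sum-replicate-zero n
∑-sum-comm f (x ∷ xs) = trans (∑-distrib-+ (λ i → f i x) _) (cong (_ +_) (∑-sum-comm f xs))

sum-map-filter : {P : A → Set} (P? : Decidable P) (f : A → ℕ) (xs : List A) →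
                 sum (map f (filter P? xs)) ≡ sum (map (λ x → 𝟙 (P? x) * f x) xs)
sum-map-filter P? f [] = refl
sum-map-filter P? f (x ∷ xs) with P? x
... | yes _ = cong₂ _+_ (sym (ℕ.+-identityʳ (f x))) (sum-map-filter P? f xs)
... | no _ = sum-map-filter P? f xs

sum-map-≡ : {f : A → ℕ} {c : ℕ} (xs : List A) → (∀ x → x ∈ xs → f x ≡ c) → sum (map f xs) ≡ length xs * c
sum-map-≡ [] _ = refl
sum-map-≡ (x ∷ xs) f≡c = cong₂ _+_ (f≡c x (here refl)) (sum-map-≡ xs λ y y∈ → f≡c y (there y∈))

sum-map-≥ : {f : A → ℕ} {c : ℕ} (xs : List A) → (∀ x → x ∈ xs → c ≤ f x) → length xs * c ≤ sum (map f xs)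
sum-map-≥ [] _ = z≤n
sum-map-≥ (x ∷ xs) c≤f = ℕ.+-mono-≤ (c≤f x (here refl)) (sum-map-≥ xs λ y y∈ → c≤f y (there y∈))

-- Discharging

-- what an endpoint of degree d receives from an edge whose other endpoint has degree d′
share : ℕ → ℕ → ℕ → ℕ
share X (suc zero) _ = X
share X _ (suc zero) = 12 ∸ X
share X _ _ = 6

share-pair : ∀ X d d′ → X ≤ 12 → d ≢ 1 ⊎ d′ ≢ 1 → share X d d′ + share X d′ d ≡ 12
share-pair X 1 1 _ (inj₁ 1≢1) = contradiction refl 1≢1
share-pair X 1 1 _ (inj₂ 1≢1) = contradiction refl 1≢1
share-pair X 1 0 X≤12 _ = ℕ.m+[n∸m]≡n X≤12
share-pair X 1 (suc (suc _)) X≤12 _ = ℕ.m+[n∸m]≡n X≤12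
share-pair X 0 1 X≤12 _ = ℕ.m∸n+n≡m X≤12
share-pair X (suc (suc _)) 1 X≤12 _ = ℕ.m∸n+n≡m X≤12
share-pair X 0 0 _ _ = refl
share-pair X 0 (suc (suc _)) _ _ = refl
share-pair X (suc (suc _)) 0 _ _ = refl
share-pair X (suc (suc _)) (suc (suc _)) _ _ = refl

share-≥ : ∀ X d d′ → 6 ≤ X → d ≢ 1 → 12 ∸ X ≤ share X d d′
share-≥ X 1 _ _ 1≢1 = contradiction refl 1≢1
share-≥ X 0 1 _ _ = ℕ.≤-refl
share-≥ X (suc (suc _)) 1 _ _ = ℕ.≤-refl
share-≥ X 0 0 6≤X _ = ℕ.∸-monoʳ-≤ 12 6≤X
share-≥ X 0 (suc (suc _)) 6≤X _ = ℕ.∸-monoʳ-≤ 12 6≤X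
share-≥ X (suc (suc _)) 0 6≤X _ = ℕ.∸-monoʳ-≤ 12 6≤X
share-≥ X (suc (suc _)) (suc (suc _)) 6≤X _ = ℕ.∸-monoʳ-≤ 12 6≤X

share-inner : ∀ X d d′ → d ≢ 1 → d′ ≢ 1 → share X d d′ ≡ 6
share-inner X 1 _ 1≢1 _ = contradiction refl 1≢1
share-inner X _ 1 _ 1≢1 = contradiction refl 1≢1
share-inner X 0 0 _ _ = refl
share-inner X 0 (suc (suc _)) _ _ = refl
share-inner X (suc (suc _)) 0 _ _ = refl
share-inner X (suc (suc _)) (suc (suc _)) _ _ = refl

gift : ℕ → List (Pair n) → Fin n → Pair n → ℕ
gift X D v e = share X (degree D v) (degree D (otherEnd e v))

charge : ℕ → List (Pair n) → Fin n → ℕ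
charge X D v = sum (map (gift X D v) (incident D v))

𝟙-∈₂-* : (e : Pair n) (f : Fin n → ℕ) (v : Fin n) →
         𝟙 (v ∈₂? e) * f v ≡ 𝟙 (v F.≟ lo e) * f (lo e) + 𝟙 (v F.≟ hi e) * f (hi e)
𝟙-∈₂-* e f v with v F.≟ lo e | v F.≟ hi e
... | yes refl | yes v≡hi = contradiction v≡hi (lo≢hi e)
... | yes refl | no _ = sym (ℕ.+-identityʳ (1 * f (lo e)))
... | no _ | yes refl = refl
... | no _ | no _ = refl

∑-charge : (X : ℕ) (D : List (Pair n)) → X ≤ 12 →
           (∀ e → e ∈ D → degree D (lo e) ≢ 1 ⊎ degree D (hi e) ≢ 1) →
           ∑[ v < n ] charge X D v ≡ length D * 12
∑-charge {n} X D X≤12 noIsolatedEdge = begin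
  ∑[ v < n ] charge X D v                                     ≡⟨ sum-cong-≗ (λ v → sum-map-filter (v ∈₂?_) (gift X D v) D) ⟩
  ∑[ v < n ] sum (map (λ e → 𝟙 (v ∈₂? e) * gift X D v e) D)   ≡⟨ ∑-sum-comm (λ v e → 𝟙 (v ∈₂? e) * gift X D v e) D ⟩
  sum (map (λ e → ∑[ v < n ] (𝟙 (v ∈₂? e) * gift X D v e)) D) ≡⟨ sum-map-≡ D edgeTotal ⟩
  length D * 12                                               ∎
  where
  open ≡-Reasoning
  edgeTotal : ∀ e → e ∈ D → ∑[ v < n ] (𝟙 (v ∈₂? e) * gift X D v e) ≡ 12
  edgeTotal e e∈D = begin
    ∑[ v < n ] (𝟙 (v ∈₂? e) * gift X D v e)
      ≡⟨ sum-cong-≗ (𝟙-∈₂-* e (λ v → gift X D v e)) ⟩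
    ∑[ v < n ] (𝟙 (v F.≟ lo e) * gift X D (lo e) e + 𝟙 (v F.≟ hi e) * gift X D (hi e) e)
      ≡⟨ ∑-distrib-+ (λ v → 𝟙 (v F.≟ lo e) * gift X D (lo e) e) _ ⟩
    ∑[ v < n ] (𝟙 (v F.≟ lo e) * gift X D (lo e) e) + ∑[ v < n ] (𝟙 (v F.≟ hi e) * gift X D (hi e) e)
      ≡⟨ cong₂ _+_ (∑-𝟙≟ (lo e) _) (∑-𝟙≟ (hi e) _) ⟩
    gift X D (lo e) e + gift X D (hi e) e
      ≡⟨ cong₂ (λ a b → share X (degree D (lo e)) (degree D a) + share X (degree D (hi e)) (degree D b))
               (otherEnd-lo e) (otherEnd-hi e) ⟩
    share X (degree D (lo e)) (degree D (hi e)) + share X (degree D (hi e)) (degree D (lo e))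
      ≡⟨ share-pair X _ _ X≤12 (noIsolatedEdge e e∈D) ⟩
    12 ∎

gift-leaf : {X : ℕ} {D : List (Pair n)} {v : Fin n} (e : Pair n) → degree D v ≡ 1 → gift X D v e ≡ X
gift-leaf {X = X} {D} {v} e d≡1 = cong (λ d → share X d (degree D (otherEnd e v))) d≡1

≢0,1⇒2≤ : {d : ℕ} → d ≢ 0 → d ≢ 1 → 2 ≤ d
≢0,1⇒2≤ {0} d≢0 _ = contradiction refl d≢0
≢0,1⇒2≤ {1} _ d≢1 = contradiction refl d≢1
≢0,1⇒2≤ {suc (suc _)} _ _ = s≤s (s≤s z≤n)

≢0,1,2⇒3≤ : {d : ℕ} → d ≢ 0 → d ≢ 1 → d ≢ 2 → 3 ≤ d
≢0,1,2⇒3≤ {0} d≢0 _ _ = contradiction refl d≢0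
≢0,1,2⇒3≤ {1} _ d≢1 _ = contradiction refl d≢1
≢0,1,2⇒3≤ {2} _ _ d≢2 = contradiction refl d≢2
≢0,1,2⇒3≤ {suc (suc (suc _))} _ _ _ = s≤s (s≤s (s≤s z≤n))

8≤charge : (D : List (Pair n)) (v : Fin n) → degree D v ≢ 0 → 8 ≤ charge 8 D v
8≤charge D v d≢0 with degree D v ≟ 1
... | yes d≡1 = subst (_≤ charge 8 D v) (cong (_* 8) d≡1)
                  (sum-map-≥ (incident D v) λ e _ → ℕ.≤-reflexive (sym (gift-leaf {D = D} {v} e d≡1)))
... | no d≢1 = ℕ.≤-trans (ℕ.*-monoˡ-≤ 4 (≢0,1⇒2≤ d≢0 d≢1))
                  (sum-map-≥ (incident D v) λ e _ → share-≥ 8 _ _ (ℕ.m≤m+n 6 2) d≢1)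

9≤charge-of-degree-2 : {D : List (Pair n)} {v : Fin n} {e₁ e₂ : Pair n} →
                       degree D v ≢ 1 → incident D v ≡ e₁ ∷ e₂ ∷ [] →
                degree D (otherEnd e₁ v) ≢ 1 ⊎ degree D (otherEnd e₂ v) ≢ 1 → 9 ≤ charge 9 D v
9≤charge-of-degree-2 {D = D} {v} {e₁} {e₂} d≢1 incident≡ inner =
  subst (9 ≤_) (cong (sum ∘ map (gift 9 D v)) (sym incident≡)) (byInner inner)
  where
  byInner : degree D (otherEnd e₁ v) ≢ 1 ⊎ degree D (otherEnd e₂ v) ≢ 1 →
            9 ≤ gift 9 D v e₁ + (gift 9 D v e₂ + 0)
  byInner (inj₁ d₁≢1) = ℕ.+-mono-≤ (ℕ.≤-reflexive (sym (share-inner 9 _ _ d≢1 d₁≢1)))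
                                   (ℕ.+-mono-≤ (share-≥ 9 _ _ (ℕ.m≤m+n 6 3) d≢1) z≤n)
  byInner (inj₂ d₂≢1) = ℕ.+-mono-≤ (share-≥ 9 _ _ (ℕ.m≤m+n 6 3) d≢1)
                                   (ℕ.+-mono-≤ (ℕ.≤-reflexive (sym (share-inner 9 _ _ d≢1 d₂≢1))) z≤n)

9≤charge : {D : List (Pair n)} {z : Fin n} → 3 ≤ n → Unique D → IsDoublyResolving D →
           degree D z ≡ 0 → (v : Fin n) → v ≢ z → 9 ≤ charge 9 D v
9≤charge {D = D} {z} 3≤n unique resolving dz≡0 v v≢z with degree D v ≟ 0 | degree D v ≟ 1 | degree D v ≟ 2
... | yes d≡0 | _ | _ = contradiction (isolated-unique 3≤n resolving d≡0 dz≡0) v≢z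
... | no _ | yes d≡1 | _ = subst (_≤ charge 9 D v) (cong (_* 9) d≡1)
                              (sum-map-≥ (incident D v) λ e _ → ℕ.≤-reflexive (sym (gift-leaf {D = D} {v} e d≡1)))
... | no d≢0 | no d≢1 | no d≢2 = ℕ.≤-trans (ℕ.*-monoˡ-≤ 3 (≢0,1,2⇒3≤ d≢0 d≢1 d≢2))
                                   (sum-map-≥ (incident D v) λ e _ → share-≥ 9 _ _ (ℕ.m≤m+n 6 3) d≢1)
... | no _ | no d≢1 | yes d≡2 with length≡2⇒∷∷ d≡2
...   | e₁ , e₂ , incident≡ with degree D (otherEnd e₁ v) ≟ 1
...     | no d₁≢1 = 9≤charge-of-degree-2 {D = D} d≢1 incident≡ (inj₁ d₁≢1)
...     | yes d₁≡1 = 9≤charge-of-degree-2 {D = D} d≢1 incident≡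
                       (inj₂ (¬isolatedCherry unique resolving dz≡0 incident≡ d₁≡1))

-- The lower bound

⌈2n/3⌉≤ : (n m : ℕ) → 2 * n ≤ 3 * m → ceil2n/3 n ≤ m
⌈2n/3⌉≤ n m 2n≤3m = ℕ.≤-pred (m<n*o⇒m/o<n (subst (2 * n + 2 <_) (identity m) (s≤s (ℕ.+-monoˡ-≤ 2 2n≤3m))))
  where
  identity : ∀ m → suc (3 * m + 2) ≡ suc m * 3
  identity = solve-∀

n*8≤m*12⇒2n≤3m : (n m : ℕ) → n * 8 ≤ m * 12 → 2 * n ≤ 3 * m
n*8≤m*12⇒2n≤3m n m le = ℕ.*-cancelˡ-≤ 4 (subst₂ _≤_ (lhs n) (rhs m) le)
  where
  lhs : ∀ n → n * 8 ≡ 4 * (2 * n)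
  lhs = solve-∀
  rhs : ∀ m → m * 12 ≡ 4 * (3 * m)
  rhs = solve-∀

n*9≤m*12+9⇒2n≤3m : (n m : ℕ) → 6 ≤ n → n * 9 ≤ m * 12 + 9 → 2 * n ≤ 3 * m
n*9≤m*12+9⇒2n≤3m n m 6≤n le with 2 * n ≤? 3 * m
... | yes 2n≤3m = 2n≤3m
... | no 2n≰3m = contradiction (ℕ.+-cancelˡ-≤ (8 * n) n 5 8n+n≤8n+5) (ℕ.<⇒≱ 6≤n)
  where
  open ℕ.≤-Reasoning
  e₁ : ∀ n → 8 * n + n ≡ n * 9
  e₁ = solve-∀
  e₂ : ∀ m → m * 12 + 9 ≡ 4 * (1 + 3 * m) + 5
  e₂ = solve-∀
  e₃ : ∀ n → 4 * (2 * n) + 5 ≡ 8 * n + 5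
  e₃ = solve-∀
  8n+n≤8n+5 : 8 * n + n ≤ 8 * n + 5
  8n+n≤8n+5 = begin
    8 * n + n           ≡⟨ e₁ n ⟩
    n * 9               ≤⟨ le ⟩
    m * 12 + 9          ≡⟨ e₂ m ⟩
    4 * (1 + 3 * m) + 5 ≤⟨ ℕ.+-monoˡ-≤ 5 (ℕ.*-monoʳ-≤ 4 (ℕ.≰⇒> 2n≰3m)) ⟩
    4 * (2 * n) + 5     ≡⟨ e₃ n ⟩
    8 * n + 5           ∎

15≤⇒3≤ : 15 ≤ n → 3 ≤ n
15≤⇒3≤ = ℕ.≤-trans (ℕ.m≤m+n 3 12)

lowerBound : 15 ≤ n → (D : List (Pair n)) → Unique D → IsDoublyResolving D → ceil2n/3 n ≤ length D
lowerBound {n} 15≤n D unique resolving = ⌈2n/3⌉≤ n (length D) (2n≤3m (F.any? λ z → degree D z ≟ 0))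
  where
  open ℕ.≤-Reasoning
  3≤n = 15≤⇒3≤ 15≤n
  noIsolatedEdge : ∀ e → e ∈ D → degree D (lo e) ≢ 1 ⊎ degree D (hi e) ≢ 1
  noIsolatedEdge e e∈D with degree D (lo e) ≟ 1
  ... | yes dlo≡1 = inj₂ (¬isolatedEdge 3≤n resolving e∈D dlo≡1)
  ... | no dlo≢1 = inj₁ dlo≢1
  2n≤3m : Dec (∃ λ z → degree D z ≡ 0) → 2 * n ≤ 3 * length D
  2n≤3m (no noIsolated) = n*8≤m*12⇒2n≤3m n (length D) (begin
    n * 8                   ≡⟨ ∑-const n 8 ⟨
    ∑[ v < n ] 8            ≤⟨ ∑-mono-≤ (λ v → 8≤charge D v (λ d≡0 → noIsolated (v , d≡0))) ⟩
    ∑[ v < n ] charge 8 D v ≡⟨ ∑-charge 8 D (ℕ.m≤m+n 8 4) noIsolatedEdge ⟩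
    length D * 12           ∎)
  2n≤3m (yes (z , dz≡0)) = n*9≤m*12+9⇒2n≤3m n (length D) (ℕ.≤-trans (ℕ.m≤m+n 6 9) 15≤n) (begin
    n * 9                                                 ≡⟨ ∑-const n 9 ⟨
    ∑[ v < n ] 9                                          ≤⟨ ∑-mono-≤ nine≤ ⟩
    ∑[ v < n ] (charge 9 D v + 𝟙 (v F.≟ z) * 9)           ≡⟨ ∑-distrib-+ (charge 9 D) _ ⟩
    ∑[ v < n ] charge 9 D v + ∑[ v < n ] (𝟙 (v F.≟ z) * 9)
      ≡⟨ cong₂ _+_ (∑-charge 9 D (ℕ.m≤m+n 9 3) noIsolatedEdge) (∑-𝟙≟ z 9) ⟩
    length D * 12 + 9                                     ∎)
    where
    nine≤ : ∀ v → 9 ≤ charge 9 D v + 𝟙 (v F.≟ z) * 9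
    nine≤ v with v F.≟ z
    ... | yes _ = ℕ.m≤n+m 9 (charge 9 D v)
    ... | no v≢z = ℕ.≤-trans (9≤charge 3≤n unique resolving dz≡0 v v≢z) (ℕ.m≤m+n _ _)

-- Resolving sets from star forests

DistinguishedBy : List (Pair n) → Set
DistinguishedBy D = ∀ {u v} → u ≢ v → ¬ Indistinguishable D u v

AvoidedBy : List (Pair n) → Set
AvoidedBy D = ∀ u v → ∃ λ y → y ∈ D × ∣ u ∩ y ∣ ≡ 0 × ∣ v ∩ y ∣ ≡ 0

distinguished∧avoided⇒DoublyResolving : {D : List (Pair n)} → DistinguishedBy D → AvoidedBy D → IsDoublyResolving D
distinguished∧avoided⇒DoublyResolving {D = D} distinguished avoided u v u≢v
  with All.all? (λ x → ∣ u ∩ x ∣ ≟ ∣ v ∩ x ∣) D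
... | yes same = contradiction (λ x x∈D → All.lookup same x∈D) (distinguished u≢v)
... | no ¬same with find (¬All⇒Any¬ (λ x → ∣ u ∩ x ∣ ≟ ∣ v ∩ x ∣) D ¬same) | avoided u v
...   | x , x∈D , ux≢vx | y , y∈D , uy≡0 , vy≡0 =
  x , y , x∈D , y∈D , Equivalence.from (DoublyResolves⇔ x y u v) λ eq →
    ux≢vx (trans (sym (ℕ.+-identityʳ ∣ u ∩ x ∣)) (subst₂ (λ a b → ∣ u ∩ x ∣ + a ≡ b + ∣ v ∩ x ∣) vy≡0 uy≡0 eq))

avoided-by-disjoint₅ : (y : Fin 5 → Pair n) → (∀ {i j s} → s ∈₂ y i → s ∈₂ y j → i ≡ j) →
                       (u v : Pair n) → ∃ λ j → ∣ u ∩ y j ∣ ≡ 0 × ∣ v ∩ y j ∣ ≡ 0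
avoided-by-disjoint₅ {n} y y-disjoint u v with F.any? (λ j → (∣ u ∩ y j ∣ ≟ 0) ×-dec (∣ v ∩ y j ∣ ≟ 0))
... | yes avoiding = avoiding
... | no none = ⊥-elim (collision (F.pigeonhole (ℕ.n<1+n 4) (proj₁ ∘ hit)))
  where
  point : Fin 4 → Fin n
  point 0F = lo u
  point 1F = hi u
  point 2F = lo v
  point 3F = hi v
  hit : ∀ j → ∃ λ k → point k ∈₂ y j
  hit j with ∣ u ∩ y j ∣ ≟ 0 | ∣ v ∩ y j ∣ ≟ 0
  ... | yes u≡0 | yes v≡0 = contradiction (j , u≡0 , v≡0) none
  ... | no u≢0 | _ = [ (0F ,_) , (1F ,_) ]′ (∣∩∣≢0⇒∈ u (y j) u≢0)
  ... | yes _ | no v≢0 = [ (2F ,_) , (3F ,_) ]′ (∣∩∣≢0⇒∈ v (y j) v≢0)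
  collision : ¬ ∃₂ λ i j → i F.< j × proj₁ (hit i) ≡ proj₁ (hit j)
  collision (i , j , i<j , same-point) = F.<⇒≢ i<j
    (y-disjoint (proj₂ (hit i)) (subst (λ k → point k ∈₂ y j) (sym same-point) (proj₂ (hit j))))

record SpanningStarForest (n : ℕ) : Set where
  field
    centre      : Fin n → Fin n
    centre-idem : ∀ p → centre (centre p) ≡ centre p
    two-leaves  : ∀ q → centre q ≡ q →
                  ∃₂ λ l₁ l₂ → l₁ ≢ l₂ × (l₁ ≢ q × centre l₁ ≡ q) × (l₂ ≢ q × centre l₂ ≡ q)

  StarEdges⊆ : List (Pair n) → Set
  StarEdges⊆ D = ∀ p (c≢p : centre p ≢ p) → pairOf (centre p) p c≢p ∈ D

module _ (S : SpanningStarForest n) {D : List (Pair n)} where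
  open SpanningStarForest S

  module _ (star : StarEdges⊆ D) {A B : Pair n} (indist : Indistinguishable D A B) where

    star-balance : ∀ p (c≢p : centre p ≢ p) → 𝟙 (centre p ∈₂? A) + 𝟙 (p ∈₂? A) ≡ 𝟙 (centre p ∈₂? B) + 𝟙 (p ∈₂? B)
    star-balance p c≢p = begin
      𝟙 (centre p ∈₂? A) + 𝟙 (p ∈₂? A) ≡⟨ ∣pairOf∩∣ (centre p) p c≢p A ⟨
      ∣ e ∩ A ∣                           ≡⟨ ∩-comm e A ⟩
      ∣ A ∩ e ∣                           ≡⟨ indist e (star p c≢p) ⟩
      ∣ B ∩ e ∣                           ≡⟨ ∩-comm B e ⟩
      ∣ e ∩ B ∣                           ≡⟨ ∣pairOf∩∣ (centre p) p c≢p B ⟩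
      𝟙 (centre p ∈₂? B) + 𝟙 (p ∈₂? B) ∎
      where
      open ≡-Reasoning
      e = pairOf (centre p) p c≢p

    centre⇒leaf : ∀ {p} → centre p ≢ p → centre p ∈₂ A → ¬ centre p ∈₂ B → p ∈₂ B × ¬ p ∈₂ A
    centre⇒leaf {p} c≢p = 𝟙-transfer (centre p ∈₂? A) (p ∈₂? A) (centre p ∈₂? B) (p ∈₂? B) (star-balance p c≢p)

    leaf⇒centre : ∀ {p} → centre p ≢ p → p ∈₂ A → ¬ p ∈₂ B → centre p ∈₂ B × ¬ centre p ∈₂ A
    leaf⇒centre {p} c≢p = 𝟙-transfer (p ∈₂? A) (centre p ∈₂? A) (p ∈₂? B) (centre p ∈₂? B)
      (trans (ℕ.+-comm (𝟙 (p ∈₂? A)) _) (trans (star-balance p c≢p) (ℕ.+-comm _ (𝟙 (p ∈₂? B)))))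

    centre∉A∖B : ∀ {q} → centre q ≡ q → q ∈₂ A → ¬ q ∈₂ B → ⊥
    centre∉A∖B {q} cq≡q q∈A q∉B with two-leaves q cq≡q
    ... | l₁ , l₂ , l₁≢l₂ , (l₁≢q , cl₁≡q) , (l₂≢q , cl₂≡q) = resolve (centre w F.≟ w)
      where
      leaf∈B∖A : ∀ {l} → l ≢ q → centre l ≡ q → l ∈₂ B × ¬ l ∈₂ A
      leaf∈B∖A l≢q cl≡q = centre⇒leaf (λ cl≡l → l≢q (trans (sym cl≡l) cl≡q))
                            (subst (_∈₂ A) (sym cl≡q) q∈A) (subst (λ c → ¬ c ∈₂ B) (sym cl≡q) q∉B)
      B≡l₁l₂ : B ≡ pairOf l₁ l₂ l₁≢l₂
      B≡l₁l₂ = pair-unique l₁≢l₂ (proj₁ (leaf∈B∖A l₁≢q cl₁≡q)) (proj₁ (leaf∈B∖A l₂≢q cl₂≡q))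
                 (∈-pairOfˡ l₁ l₂ l₁≢l₂) (∈-pairOfʳ l₁ l₂ l₁≢l₂)
      centre-on-B : ∀ {y} → y ∈₂ B → centre y ≡ q
      centre-on-B {y} y∈B with ∈-pairOf⁻ l₁ l₂ l₁≢l₂ (subst (y ∈₂_) B≡l₁l₂ y∈B)
      ... | inj₁ refl = cl₁≡q
      ... | inj₂ refl = cl₂≡q
      w = otherEnd A q
      w∈A = otherEnd-∈ A q∈A
      w∉B : ¬ w ∈₂ B
      w∉B w∈B with ∈-pairOf⁻ l₁ l₂ l₁≢l₂ (subst (w ∈₂_) B≡l₁l₂ w∈B)
      ... | inj₁ refl = proj₂ (leaf∈B∖A l₁≢q cl₁≡q) w∈A
      ... | inj₂ refl = proj₂ (leaf∈B∖A l₂≢q cl₂≡q) w∈A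
      resolve : Dec (centre w ≡ w) → ⊥
      resolve (yes cw≡w) with two-leaves w cw≡w
      ... | l , _ , _ , (l≢w , cl≡w) , _ =
        otherEnd-≢ A q∈A (trans (sym cl≡w) (centre-on-B (proj₁ (centre⇒leaf (λ cl≡l → l≢w (trans (sym cl≡l) cl≡w))
          (subst (_∈₂ A) (sym cl≡w) w∈A) (subst (λ c → ¬ c ∈₂ B) (sym cl≡w) w∉B)))))
      resolve (no cw≢w) = q∉B (subst (_∈₂ B) (trans (sym (centre-idem w)) (centre-on-B cw∈B)) cw∈B)
        where
        cw∈B = proj₁ (leaf⇒centre cw≢w w∈A w∉B)

  ∉A∖B : StarEdges⊆ D → ∀ {A B} → Indistinguishable D A B → ∀ {p} → p ∈₂ A → ¬ p ∈₂ B → ⊥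
  ∉A∖B star {A} {B} indist {p} p∈A p∉B with centre p F.≟ p
  ... | yes cp≡p = centre∉A∖B star {A} {B} indist cp≡p p∈A p∉B
  ... | no cp≢p = centre∉A∖B star {B} {A} (λ x x∈D → sym (indist x x∈D)) (centre-idem p) cp∈B cp∉A
    where
    cp∈B×cp∉A = leaf⇒centre star {A} {B} indist cp≢p p∈A p∉B
    cp∈B = proj₁ cp∈B×cp∉A
    cp∉A = proj₂ cp∈B×cp∉A

  starEdges⇒distinguished : StarEdges⊆ D → DistinguishedBy D
  starEdges⇒distinguished star {u} {v} u≢v indist with lo u ∈₂? v | hi u ∈₂? v
  ... | no lo∉v | _ = ∉A∖B star {u} {v} indist (inj₁ refl) lo∉v
  ... | yes _ | no hi∉v = ∉A∖B star {u} {v} indist (inj₂ refl) hi∉v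
  ... | yes lo∈v | yes hi∈v = u≢v (⊆⇒≡ u v lo∈v hi∈v)

module _ (S : SpanningStarForest n) where
  open SpanningStarForest S

  starEdges : List (Fin n) → List (Pair n)
  starEdges [] = []
  starEdges (p ∷ ps) with centre p F.≟ p
  ... | yes _ = starEdges ps
  ... | no c≢p = pairOf (centre p) p c≢p ∷ starEdges ps

  ∈-starEdges⁺ : ∀ {p ps} → p ∈ ps → (c≢p : centre p ≢ p) → pairOf (centre p) p c≢p ∈ starEdges ps
  ∈-starEdges⁺ {ps = p ∷ _} (here refl) c≢p with centre p F.≟ p
  ... | yes c≡p = contradiction c≡p c≢p
  ... | no _ = here refl
  ∈-starEdges⁺ {ps = q ∷ _} (there p∈) c≢p with centre q F.≟ q
  ... | yes _ = ∈-starEdges⁺ p∈ c≢p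
  ... | no _ = there (∈-starEdges⁺ p∈ c≢p)

  ∈-starEdges⁻ : ∀ {x} ps → x ∈ starEdges ps → ∃ λ p → p ∈ ps × Σ (centre p ≢ p) λ c≢p → x ≡ pairOf (centre p) p c≢p
  ∈-starEdges⁻ (p ∷ ps) x∈ with centre p F.≟ p | x∈
  ... | yes _ | x∈′ = let q , q∈ , rest = ∈-starEdges⁻ ps x∈′ in q , there q∈ , rest
  ... | no c≢p | here refl = p , here refl , c≢p , refl
  ... | no _ | there x∈′ = let q , q∈ , rest = ∈-starEdges⁻ ps x∈′ in q , there q∈ , rest

  starEdge-injective : ∀ {p p′} (c≢p : centre p ≢ p) (c≢p′ : centre p′ ≢ p′) →
                       pairOf (centre p) p c≢p ≡ pairOf (centre p′) p′ c≢p′ → p ≡ p′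
  starEdge-injective {p} {p′} c≢p c≢p′ eq
    with ∈-pairOf⁻ (centre p′) p′ c≢p′ (subst (p ∈₂_) eq (∈-pairOfʳ (centre p) p c≢p))
  ... | inj₂ p≡p′ = p≡p′
  ... | inj₁ p≡cp′ = contradiction (trans (cong centre p≡cp′) (trans (centre-idem p′) (sym p≡cp′))) c≢p

  starEdges-unique : ∀ {ps} → Unique ps → Unique (starEdges ps)
  starEdges-unique {[]} [] = []
  starEdges-unique {p ∷ ps} (p∉ps ∷ unique) with centre p F.≟ p
  ... | yes _ = starEdges-unique unique
  ... | no c≢p = All.tabulate fresh ∷ starEdges-unique unique
    where
    fresh : ∀ {x} → x ∈ starEdges ps → pairOf (centre p) p c≢p ≢ x
    fresh x∈ with ∈-starEdges⁻ ps x∈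
    ... | q , q∈ps , c≢q , refl = All.lookup p∉ps q∈ps ∘ starEdge-injective c≢p c≢q

  length-starEdges : ∀ {m} (f : Fin m → Fin n) →
                     length (starEdges (tabulate f)) ≡ ∑[ i < m ] 𝟙 (¬? (centre (f i) F.≟ f i))
  length-starEdges {zero} f = refl
  length-starEdges {suc m} f with centre (f F.zero) F.≟ f F.zero
  ... | yes _ = length-starEdges (f ∘ F.suc)
  ... | no _ = cong suc (length-starEdges (f ∘ F.suc))

-- The upper bound

blockCentre : ℕ → ℕ
blockCentre 0 = 2
blockCentre 1 = 2
blockCentre 2 = 2
blockCentre (suc (suc (suc q))) = 3 + blockCentre q

blockCentre-≥ : ∀ q → q ≤ blockCentre q
blockCentre-≥ 0 = z≤n
blockCentre-≥ 1 = s≤s z≤n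
blockCentre-≥ 2 = s≤s (s≤s z≤n)
blockCentre-≥ (suc (suc (suc q))) = s≤s (s≤s (s≤s (blockCentre-≥ q)))

blockCentre-≤ : ∀ q → blockCentre q ≤ 2 + q
blockCentre-≤ 0 = ℕ.≤-refl
blockCentre-≤ 1 = s≤s (s≤s z≤n)
blockCentre-≤ 2 = s≤s (s≤s z≤n)
blockCentre-≤ (suc (suc (suc q))) = s≤s (s≤s (s≤s (blockCentre-≤ q)))

blockCentre-idem : ∀ q → blockCentre (blockCentre q) ≡ blockCentre q
blockCentre-idem 0 = refl
blockCentre-idem 1 = refl
blockCentre-idem 2 = refl
blockCentre-idem (suc (suc (suc q))) = cong (3 +_) (blockCentre-idem q)

blockCentre-*3 : ∀ j → blockCentre (j * 3) ≡ j * 3 + 2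
blockCentre-*3 zero = refl
blockCentre-*3 (suc j) = cong (3 +_) (blockCentre-*3 j)

blockCentre-*3+2 : ∀ j → blockCentre (j * 3 + 2) ≡ j * 3 + 2
blockCentre-*3+2 zero = refl
blockCentre-*3+2 (suc j) = cong (3 +_) (blockCentre-*3+2 j)

blockCentre-leaves : ∀ q → blockCentre q ≡ q → 2 ≤ q × blockCentre (q ∸ 1) ≡ q × blockCentre (q ∸ 2) ≡ q
blockCentre-leaves 2 _ = s≤s (s≤s z≤n) , refl , refl
blockCentre-leaves (suc (suc (suc q))) bc≡ with blockCentre-leaves q (ℕ.+-cancelˡ-≡ 3 _ _ bc≡)
... | s≤s (s≤s _) , bc₁ , bc₂ = s≤s (s≤s z≤n) , cong (3 +_) bc₁ , cong (3 +_) bc₂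

isLeafℕ : ℕ → ℕ
isLeafℕ q = 𝟙 (¬? (blockCentre q ≟ q))

ceil2n/3-+3 : ∀ m → ceil2n/3 (3 + m) ≡ 2 + ceil2n/3 m
ceil2n/3-+3 m = begin
  (2 * (3 + m) + 2) / 3         ≡⟨ cong (_/ 3) (identity m) ⟩
  (3 + (3 + (2 * m + 2))) / 3   ≡⟨ m/n≡1+[m∸n]/n {3 + (3 + (2 * m + 2))} {3} (ℕ.m≤m+n 3 _) ⟩
  1 + (3 + (2 * m + 2)) / 3     ≡⟨ cong suc (m/n≡1+[m∸n]/n {3 + (2 * m + 2)} {3} (ℕ.m≤m+n 3 _)) ⟩
  2 + (2 * m + 2) / 3           ∎
  where
  open ≡-Reasoning
  identity : ∀ m → 2 * (3 + m) + 2 ≡ 3 + (3 + (2 * m + 2))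
  identity = solve-∀

∑-isLeafℕ : ∀ m → ∑[ i < m ] isLeafℕ (F.toℕ i) ≡ ceil2n/3 m
∑-isLeafℕ 0 = refl
∑-isLeafℕ 1 = refl
∑-isLeafℕ 2 = refl
∑-isLeafℕ (suc (suc (suc m))) = trans (cong (2 +_) (∑-isLeafℕ m)) (sym (ceil2n/3-+3 m))

∸-distinct : ∀ {q} → 2 ≤ q → q ∸ 1 ≢ q ∸ 2 × q ∸ 1 ≢ q × q ∸ 2 ≢ q
∸-distinct {suc (suc q)} (s≤s (s≤s _)) = ℕ.1+n≢n , ℕ.1+n≢n ∘ sym , ℕ.<⇒≢ (ℕ.m<n⇒m<1+n (ℕ.n<1+n q))

∸3< : ∀ {c q} → 3 ≤ c → c ≤ 2 + q → c ∸ 3 < q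
∸3< (s≤s (s≤s (s≤s _))) (s≤s (s≤s c≤q)) = c≤q

module _ {n : ℕ} (3≤n : 3 ≤ n) where

  -- the points beyond the last complete block belong to its star
  clampedCentre : ℕ → ℕ
  clampedCentre q with blockCentre q <? n
  ... | yes _ = blockCentre q
  ... | no _ = blockCentre q ∸ 3

  clampedCentre-< : ∀ {q} → blockCentre q < n → clampedCentre q ≡ blockCentre q
  clampedCentre-< {q} bc<n with blockCentre q <? n
  ... | yes _ = refl
  ... | no bc≮n = contradiction bc<n bc≮n

  clampedCentre-fixed×< : ∀ {q} → q < n → blockCentre (clampedCentre q) ≡ clampedCentre q × clampedCentre q < n
  clampedCentre-fixed×< {q} q<n with blockCentre q <? n
  ... | yes bc<n = blockCentre-idem q , bc<n
  ... | no bc≮n = ℕ.+-cancelˡ-≡ 3 _ _ bc-shift , ℕ.<-trans (∸3< 3≤bc (blockCentre-≤ q)) q<n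
    where
    3≤bc : 3 ≤ blockCentre q
    3≤bc = ℕ.≤-trans 3≤n (ℕ.≮⇒≥ bc≮n)
    t = blockCentre q ∸ 3
    bc≡3+t : blockCentre q ≡ 3 + t
    bc≡3+t = sym (ℕ.m+[n∸m]≡n 3≤bc)
    bc-shift : 3 + blockCentre t ≡ 3 + t
    bc-shift = begin
      blockCentre (3 + t)         ≡⟨ cong blockCentre bc≡3+t ⟨
      blockCentre (blockCentre q) ≡⟨ blockCentre-idem q ⟩
      blockCentre q               ≡⟨ bc≡3+t ⟩
      3 + t                       ∎
      where open ≡-Reasoning

  centre : Fin n → Fin n
  centre p = F.fromℕ< (proj₂ (clampedCentre-fixed×< (F.toℕ<n p)))

  toℕ-centre : ∀ p → F.toℕ (centre p) ≡ clampedCentre (F.toℕ p)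
  toℕ-centre p = F.toℕ-fromℕ< _

  centre≡⇔ : ∀ p → (centre p ≡ p) ⇔ (blockCentre (F.toℕ p) ≡ F.toℕ p)
  centre≡⇔ p = mk⇔
    (λ cp≡p → let clamped≡ = trans (sym (toℕ-centre p)) (cong F.toℕ cp≡p) in
      trans (cong blockCentre (sym clamped≡)) (trans (proj₁ (clampedCentre-fixed×< (F.toℕ<n p))) clamped≡))
    (λ bc≡ → F.toℕ-injective (trans (toℕ-centre p)
      (trans (clampedCentre-< (subst (_< n) (sym bc≡) (F.toℕ<n p))) bc≡)))

  below : Fin n → ℕ → Fin n
  below p k = F.fromℕ< (ℕ.≤-<-trans (ℕ.m∸n≤m (F.toℕ p) k) (F.toℕ<n p))

  blockForest : SpanningStarForest n
  blockForest = record
    { centre = centre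
    ; centre-idem = λ p → Equivalence.from (centre≡⇔ (centre p))
        (subst (λ c → blockCentre c ≡ c) (sym (toℕ-centre p)) (proj₁ (clampedCentre-fixed×< (F.toℕ<n p))))
    ; two-leaves = two-leaves
    }
    where
    two-leaves : ∀ q → centre q ≡ q → ∃₂ λ l₁ l₂ → l₁ ≢ l₂ × (l₁ ≢ q × centre l₁ ≡ q) × (l₂ ≢ q × centre l₂ ≡ q)
    two-leaves q cq≡q with blockCentre-leaves (F.toℕ q) (Equivalence.to (centre≡⇔ q) cq≡q)
    ... | 2≤q , bc₁ , bc₂ with ∸-distinct 2≤q
    ...   | Q-1≢Q-2 , Q-1≢Q , Q-2≢Q =
      below q 1 , below q 2 , below≢below {1} {2} Q-1≢Q-2 ,
      (below≢q {1} Q-1≢Q , centre-below {1} bc₁) , (below≢q {2} Q-2≢Q , centre-below {2} bc₂)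
      where
      toℕ-below : ∀ k → F.toℕ (below q k) ≡ F.toℕ q ∸ k
      toℕ-below k = F.toℕ-fromℕ< _
      centre-below : ∀ {k} → blockCentre (F.toℕ q ∸ k) ≡ F.toℕ q → centre (below q k) ≡ q
      centre-below {k} bc≡ = F.toℕ-injective (begin
        F.toℕ (centre (below q k))      ≡⟨ toℕ-centre (below q k) ⟩
        clampedCentre (F.toℕ (below q k)) ≡⟨ cong clampedCentre (toℕ-below k) ⟩
        clampedCentre (F.toℕ q ∸ k)     ≡⟨ clampedCentre-< (subst (_< n) (sym bc≡) (F.toℕ<n q)) ⟩
        blockCentre (F.toℕ q ∸ k)       ≡⟨ bc≡ ⟩
        F.toℕ q                         ∎)
        where open ≡-Reasoning
      below≢below : ∀ {k m} → F.toℕ q ∸ k ≢ F.toℕ q ∸ m → below q k ≢ below q m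
      below≢below {k} {m} ≢ eq = ≢ (trans (sym (toℕ-below k)) (trans (cong F.toℕ eq) (toℕ-below m)))
      below≢q : ∀ {k} → F.toℕ q ∸ k ≢ F.toℕ q → below q k ≢ q
      below≢q {k} ≢ eq = ≢ (trans (sym (toℕ-below k)) (cong F.toℕ eq))

  blockEdges : List (Pair n)
  blockEdges = starEdges blockForest (allFin n)

  blockEdges-star : SpanningStarForest.StarEdges⊆ blockForest blockEdges
  blockEdges-star p = ∈-starEdges⁺ blockForest (∈-allFin p)

  length-blockEdges : length blockEdges ≡ ceil2n/3 n
  length-blockEdges = begin
    length blockEdges                        ≡⟨ length-starEdges blockForest id ⟩
    ∑[ p < n ] 𝟙 (¬? (centre p F.≟ p))       ≡⟨ sum-cong-≗ isLeaf ⟩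
    ∑[ p < n ] isLeafℕ (F.toℕ p)             ≡⟨ ∑-isLeafℕ n ⟩
    ceil2n/3 n                               ∎
    where
    open ≡-Reasoning
    isLeaf : ∀ p → 𝟙 (¬? (centre p F.≟ p)) ≡ isLeafℕ (F.toℕ p)
    isLeaf p = 𝟙-cong (¬? (centre p F.≟ p)) (¬? (blockCentre (F.toℕ p) ≟ F.toℕ p))
                 (λ c≢p bc≡ → c≢p (Equivalence.from (centre≡⇔ p) bc≡))
                 (λ bc≢ c≡p → bc≢ (Equivalence.to (centre≡⇔ p) c≡p))

module _ {n : ℕ} (15≤n : 15 ≤ n) where
  private
    3≤n = 15≤⇒3≤ 15≤n

  bc[j*3]<n : (j : Fin 5) → blockCentre (F.toℕ j * 3) < n
  bc[j*3]<n j = subst (_< n) (sym (blockCentre-*3 (F.toℕ j)))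
    (ℕ.≤-trans (s≤s (ℕ.+-monoˡ-≤ 2 (ℕ.*-monoˡ-≤ 3 (ℕ.≤-pred (F.toℕ<n j))))) 15≤n)

  blockStart : Fin 5 → Fin n
  blockStart j = F.fromℕ< (ℕ.≤-<-trans (blockCentre-≥ (F.toℕ j * 3)) (bc[j*3]<n j))

  toℕ-blockStart : ∀ j → F.toℕ (blockStart j) ≡ F.toℕ j * 3
  toℕ-blockStart j = F.toℕ-fromℕ< _

  toℕ-centre-blockStart : ∀ j → F.toℕ (centre 3≤n (blockStart j)) ≡ F.toℕ j * 3 + 2
  toℕ-centre-blockStart j = begin
    F.toℕ (centre 3≤n (blockStart j))        ≡⟨ toℕ-centre 3≤n (blockStart j) ⟩
    clampedCentre 3≤n (F.toℕ (blockStart j)) ≡⟨ cong (clampedCentre 3≤n) (toℕ-blockStart j) ⟩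
    clampedCentre 3≤n (F.toℕ j * 3)          ≡⟨ clampedCentre-< 3≤n (bc[j*3]<n j) ⟩
    blockCentre (F.toℕ j * 3)                ≡⟨ blockCentre-*3 (F.toℕ j) ⟩
    F.toℕ j * 3 + 2                          ∎
    where open ≡-Reasoning

  centre≢blockStart : ∀ j → centre 3≤n (blockStart j) ≢ blockStart j
  centre≢blockStart j c≡s = ℕ.m+1+n≢m (F.toℕ j * 3)
    (trans (sym (toℕ-centre-blockStart j)) (trans (cong F.toℕ c≡s) (toℕ-blockStart j)))

  blockEdge : Fin 5 → Pair n
  blockEdge j = pairOf (centre 3≤n (blockStart j)) (blockStart j) (centre≢blockStart j)

  blockCentre-on-blockEdge : ∀ {j s} → s ∈₂ blockEdge j → blockCentre (F.toℕ s) ≡ F.toℕ j * 3 + 2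
  blockCentre-on-blockEdge {j} s∈
    with ∈-pairOf⁻ (centre 3≤n (blockStart j)) (blockStart j) (centre≢blockStart j) s∈
  ... | inj₁ refl = trans (cong blockCentre (toℕ-centre-blockStart j)) (blockCentre-*3+2 (F.toℕ j))
  ... | inj₂ refl = trans (cong blockCentre (toℕ-blockStart j)) (blockCentre-*3 (F.toℕ j))

  blockEdges-disjoint : ∀ {i j s} → s ∈₂ blockEdge i → s ∈₂ blockEdge j → i ≡ j
  blockEdges-disjoint {i} {j} s∈i s∈j = F.toℕ-injective (ℕ.*-cancelʳ-≡ (F.toℕ i) (F.toℕ j) 3
    (ℕ.+-cancelʳ-≡ 2 (F.toℕ i * 3) (F.toℕ j * 3)
      (trans (sym (blockCentre-on-blockEdge {i} s∈i)) (blockCentre-on-blockEdge {j} s∈j))))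

  blockEdges-avoided : AvoidedBy (blockEdges 3≤n)
  blockEdges-avoided u v = let j , u∩≡0 , v∩≡0 = avoided-by-disjoint₅ blockEdge blockEdges-disjoint u v in
    blockEdge j , blockEdges-star 3≤n (blockStart j) (centre≢blockStart j) , u∩≡0 , v∩≡0

upperBound : 15 ≤ n → Σ (List (Pair n)) λ D → Unique D × IsDoublyResolving D × length D ≡ ceil2n/3 n
upperBound {n} 15≤n =
  blockEdges 3≤n ,
  starEdges-unique (blockForest 3≤n) (Unique.allFin⁺ n) ,
  distinguished∧avoided⇒DoublyResolving (starEdges⇒distinguished (blockForest 3≤n) (blockEdges-star 3≤n))
                                        (blockEdges-avoided 15≤n) ,
  length-blockEdges 3≤n
  where
  3≤n = 15≤⇒3≤ 15≤n

theorem7 : (n : ℕ) → 15 ≤ n → ψ-J2-is n (ceil2n/3 n)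
theorem7 n 15≤n = upperBound 15≤n , λ D unique resolving → lowerBound 15≤n D unique resolving
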